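{- Let $G$ be a connected graph of order $n$. Then: (a) $\gamma_{\{R2\}}(G)=n$ if and only if $G=K_n$ with $n\in\{1,2\}$; (b) $\gamma_{\{R2\}}(G)=n-1$ if and only if $G$ is isomorphic to one of $C_3$, $P_3$, $P_4$.
   Context: All graphs are finite and simple. A Roman $\{2\}$-dominating function on a graph $G=(V,E)$ is a function $f:V\to\{0,1,2\}$ such that for every vertex $v$ with $f(v)=0$, $\sum_{u\in N(v)}f(u)\geq 2$. Its weight is $\sum_{v\in V}f(v)$, and $\gamma_{\{R2\}}(G)$ is the minimum weight of such a function. $C_k$ and $P_k$ denote the cycle and path on $k$ vertices. -}

module Defs where

open import Data.Nat using (ℕ; zero; suc; _+_; _≤_; _≡ᵇ_; ∣_-_∣)
open import Data.Nat.Properties using (∣-∣-comm; ∣n-n∣≡0)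
open import Data.Bool using (Bool; true; false; if_then_else_; _∨_)
open import Data.Fin using (Fin; toℕ)
open import Data.List using (map; allFin)
open import Data.Nat.ListAction using (sum)
open import Data.Product using (Σ; _×_; _,_)
open import Function.Bundles using (_↔_; Inverse)
open import Relation.Binary.PropositionalEquality using (_≡_; _≢_; refl; cong; trans; sym)

record Graph (n : ℕ) : Set where
  field
    adj     : Fin n → Fin n → Bool
    adj-sym : ∀ u v → adj u v ≡ adj v u
    adj-irr : ∀ v → adj v v ≡ false
open Graph public

ΣV : ∀ {n} → (Fin n → ℕ) → ℕ
ΣV {n} g = sum (map g (allFin n))

data Walk {n} (G : Graph n) : Fin n → Fin n → Set where
  here : ∀ {v} → Walk G v v
  step : ∀ {u w v} → adj G u w ≡ true → Walk G w v → Walk G u v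

Connected : ∀ {n} → Graph n → Set
Connected G = ∀ u v → Walk G u v

nbrSum : ∀ {n} → Graph n → (Fin n → ℕ) → Fin n → ℕ
nbrSum G f v = ΣV (λ u → if adj G v u then f u else 0)

IsR2DF : ∀ {n} → Graph n → (Fin n → ℕ) → Set
IsR2DF G f = (∀ v → f v ≤ 2) × (∀ v → f v ≡ 0 → 2 ≤ nbrSum G f v)

weight : ∀ {n} → (Fin n → ℕ) → ℕ
weight f = ΣV f

γR2≡ : ∀ {n} → Graph n → ℕ → Set
γR2≡ G k = (Σ _ λ f → IsR2DF G f × weight f ≡ k)
         × (∀ f → IsR2DF G f → k ≤ weight f)

IsComplete : ∀ {n} → Graph n → Set
IsComplete {n} G = ∀ (u v : Fin n) → u ≢ v → adj G u v ≡ true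

_≅_ : ∀ {n m} → Graph n → Graph m → Set
_≅_ {n} {m} G H = Σ (Fin n ↔ Fin m) λ φ →
  ∀ u v → adj G u v ≡ adj H (Inverse.to φ u) (Inverse.to φ v)

dist : ∀ {k} → Fin k → Fin k → ℕ
dist i j = ∣ toℕ i - toℕ j ∣

dist-sym : ∀ {k} (i j : Fin k) → dist i j ≡ dist j i
dist-sym i j = ∣-∣-comm (toℕ i) (toℕ j)

P : (k : ℕ) → Graph k
P k = record
  { adj = λ i j → dist i j ≡ᵇ 1
  ; adj-sym = λ i j → cong (_≡ᵇ 1) (dist-sym i j)
  ; adj-irr = λ v → cong (_≡ᵇ 1) (∣n-n∣≡0 (toℕ v)) }

C+3 : (m : ℕ) → Graph (3 + m)
C+3 m = record
  { adj = λ i j → (dist i j ≡ᵇ 1) ∨ (dist i j ≡ᵇ suc (suc m))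
  ; adj-sym = λ i j → cong (λ d → (d ≡ᵇ 1) ∨ (d ≡ᵇ suc (suc m))) (dist-sym i j)
  ; adj-irr = λ v → cong (λ d → (d ≡ᵇ 1) ∨ (d ≡ᵇ suc (suc m))) (∣n-n∣≡0 (toℕ v)) }

C₃ : Graph 3
C₃ = C+3 0

-- Every Roman {2}-dominating function has weight at least min(2, n): a vertex labelled 0 sees
-- weight 2, and otherwise all n labels are positive. Since the constant labelling 1 has weight n,
-- γ = n whenever n ≤ 2. Growing a path along an edge that leaves it shows that a connected graph
-- of order greater than k contains a path on k + 1 vertices or a claw (the leaving edge starts at
-- an interior vertex). Labelling 0 the centre of a cherry (a vertex with two distinct neighbours)
-- and 1 elsewhere gives weight n − 1, so γ = n forces n ≤ 2. Weight n − 2 is reached from a claw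
-- (centre 2, leaves 0), from two cherries whose centres avoid each other, hence from a path on
-- five vertices or a 4-cycle. So γ = n − 1 forces n ∈ {3, 4} and no claw, leaving exactly C₃, P₃
-- and P₄, whose values are checked directly.

module Submission where

open import Defs
open import Data.Nat using (ℕ; zero; suc; _+_; _∸_; _≤_; _<_; _⊓_; z≤n; s≤s)
open import Data.Nat.Properties
  using (+-0-commutativeMonoid; +-comm; +-assoc; +-identityʳ; +-mono-≤; +-monoʳ-≤; ≤-refl; ≤-trans;
         m≤m+n; m≤n+m; m⊓n≤m; m⊓n≤n; <⇒≱; 1+n≰n; <⇒≤; suc-injective; +-cancelʳ-≡; +-monoˡ-≤; +-suc)
import Data.Nat.Properties as ℕ
open import Data.Bool using (true; false; if_then_else_)
open import Data.Fin using (Fin; zero; suc; toℕ; fromℕ; inject₁; lower₁; opposite; punchIn; punchOut)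
open import Data.Fin.Properties
  using (_≟_; any?; all?; ¬∀⟶∃¬; injective⇒≤; punchInᵢ≢i; punchIn-punchOut; toℕ-inject₁; toℕ-fromℕ;
         toℕ-injective; inject₁-lower₁; opposite-involutive)
open import Data.Fin.Patterns using (0F; 1F; 2F; 3F)
open import Data.Fin.Permutation using (↔⇒≡)
open import Data.List using (tabulate)
open import Data.List.Properties using (map-tabulate)
import Data.Nat.ListAction as List using (sum)
open import Data.Vec.Functional using ([]; _∷_; updateAt; removeAt)
open import Data.Vec.Functional.Properties using (updateAt-updates; updateAt-minimal)
open import Algebra.Properties.CommutativeMonoid.Sum +-0-commutativeMonoid
  using (sum; sum-remove; sum-permute; sum-cong-≗)
open import Data.Product using (∃; ∃₂; _×_; _,_; proj₁; proj₂)
open import Data.Sum using (_⊎_; inj₁; inj₂)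
open import Function using (_∘_; id; const)
open import Function.Bundles using (_↔_; _⇔_; Inverse; mk↔ₛ′; mk⇔)
open import Function.Construct.Symmetry using (↔-sym)
open import Function.Definitions using (Injective)
open import Relation.Nullary using (¬_; Dec; yes; no; contradiction)
open import Relation.Nullary.Decidable using (_×-dec_; _→-dec_; from-yes)
open import Relation.Unary using (Decidable)
open import Relation.Binary.PropositionalEquality

ΣV≡sum : ∀ {n} (g : Fin n → ℕ) → ΣV g ≡ sum g
ΣV≡sum g = trans (cong List.sum (map-tabulate id g)) (sum-tabulate g)
  where
  sum-tabulate : ∀ {n} (g : Fin n → ℕ) → List.sum (tabulate g) ≡ sum g
  sum-tabulate {zero} g = refl
  sum-tabulate {suc n} g = cong (g zero +_) (sum-tabulate (g ∘ suc))

ΣV-cong : ∀ {n} {g h : Fin n → ℕ} → (∀ i → g i ≡ h i) → ΣV g ≡ ΣV h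
ΣV-cong {g = g} {h} g≗h = trans (ΣV≡sum g) (trans (sum-cong-≗ g≗h) (sym (ΣV≡sum h)))

ΣV-mono : ∀ {n} {g h : Fin n → ℕ} → (∀ i → g i ≤ h i) → ΣV g ≤ ΣV h
ΣV-mono {g = g} {h} g≤h = subst₂ _≤_ (sym (ΣV≡sum g)) (sym (ΣV≡sum h)) (sum-mono g≤h)
  where
  sum-mono : ∀ {n} {g h : Fin n → ℕ} → (∀ i → g i ≤ h i) → sum g ≤ sum h
  sum-mono {zero} _ = z≤n
  sum-mono {suc n} g≤h = +-mono-≤ (g≤h zero) (sum-mono (g≤h ∘ suc))

ΣV-const-1 : ∀ n → ΣV {n} (const 1) ≡ n
ΣV-const-1 n = trans (ΣV≡sum {n} (const 1)) (sum-const-1 n)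
  where
  sum-const-1 : ∀ n → sum {n} (const 1) ≡ n
  sum-const-1 zero = refl
  sum-const-1 (suc n) = cong suc (sum-const-1 n)

ΣV-permute : ∀ {m n} (π : Fin m ↔ Fin n) (g : Fin n → ℕ) → ΣV g ≡ ΣV (g ∘ Inverse.to π)
ΣV-permute π g = trans (ΣV≡sum g) (trans (sum-permute g π) (sym (ΣV≡sum (g ∘ Inverse.to π))))

ΣV-split : ∀ {n} (g : Fin (suc n) → ℕ) a → ΣV g ≡ g a + sum (removeAt g a)
ΣV-split g a = trans (ΣV≡sum g) (sum-remove g)

ΣV-≥-point : ∀ {n} (g : Fin n → ℕ) a → g a ≤ ΣV g
ΣV-≥-point {suc n} g a = subst (g a ≤_) (sym (ΣV-split g a)) (m≤m+n (g a) _)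

ΣV-≥-pair : ∀ {n} (g : Fin n → ℕ) {a b} → a ≢ b → g a + g b ≤ ΣV g
ΣV-≥-pair {suc n} g {a} {b} a≢b = subst (g a + g b ≤_) (sym (ΣV-split g a))
  (+-monoʳ-≤ (g a) (subst (_≤ sum (removeAt g a)) (cong g (punchIn-punchOut a≢b))
    (subst (removeAt g a (punchOut a≢b) ≤_) (ΣV≡sum (removeAt g a))
      (ΣV-≥-point (removeAt g a) (punchOut a≢b)))))

_[_]≔_ : ∀ {n} {A : Set} → (Fin n → A) → Fin n → A → Fin n → A
f [ a ]≔ x = updateAt f a (const x)

[]≔-updates : ∀ {n} {A : Set} (f : Fin n → A) a x → (f [ a ]≔ x) a ≡ x
[]≔-updates f a x = updateAt-updates a f

[]≔-minimal : ∀ {n} {A : Set} (f : Fin n → A) {a u} x → u ≢ a → (f [ a ]≔ x) u ≡ f u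
[]≔-minimal f {a} {u} x u≢a = updateAt-minimal u a f u≢a

[]≔-zero : ∀ {n} (f : Fin n → ℕ) a x u → (f [ a ]≔ x) u ≡ 0 → u ≡ a ⊎ f u ≡ 0
[]≔-zero f a x u fu≡0 with u ≟ a
... | yes u≡a = inj₁ u≡a
... | no u≢a = inj₂ (trans (sym ([]≔-minimal f x u≢a)) fu≡0)

[]≔-bounded : ∀ {n} {m} (f : Fin n → ℕ) a {x} → (∀ u → f u ≤ m) → x ≤ m → ∀ u → (f [ a ]≔ x) u ≤ m
[]≔-bounded f a {x} f≤m x≤m u with u ≟ a
... | yes refl = subst (_≤ _) (sym ([]≔-updates f a x)) x≤m
... | no u≢a = subst (_≤ _) (sym ([]≔-minimal f x u≢a)) (f≤m u)

ΣV-update : ∀ {n} (g : Fin n → ℕ) a k → ΣV (g [ a ]≔ k) + g a ≡ ΣV g + k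
ΣV-update {suc n} g a k = begin
  ΣV (g [ a ]≔ k) + g a                        ≡⟨ cong (_+ g a) (ΣV-split (g [ a ]≔ k) a) ⟩
  (g [ a ]≔ k) a + sum (removeAt (g [ a ]≔ k) a) + g a
    ≡⟨ cong₂ (λ x y → x + y + g a) (updateAt-updates a g) (sum-cong-≗ unchanged) ⟩
  k + sum (removeAt g a) + g a                 ≡⟨ +-comm (k + sum (removeAt g a)) (g a) ⟩
  g a + (k + sum (removeAt g a))               ≡⟨ cong (g a +_) (+-comm k _) ⟩
  g a + (sum (removeAt g a) + k)               ≡⟨ sym (+-assoc (g a) _ k) ⟩
  g a + sum (removeAt g a) + k                 ≡⟨ cong (_+ k) (sym (ΣV-split g a)) ⟩
  ΣV g + k                                     ∎
  where
  open ≡-Reasoning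
  unchanged : ∀ i → removeAt (g [ a ]≔ k) a i ≡ removeAt g a i
  unchanged i = updateAt-minimal (punchIn a i) a g (punchInᵢ≢i a i)

weight-zeroOut : ∀ {n} (f : Fin n → ℕ) a → f a ≡ 1 → suc (weight (f [ a ]≔ 0)) ≡ weight f
weight-zeroOut f a fa≡1 = begin
  suc (weight (f [ a ]≔ 0))  ≡⟨ +-comm 1 _ ⟩
  weight (f [ a ]≔ 0) + 1    ≡⟨ cong (weight (f [ a ]≔ 0) +_) (sym fa≡1) ⟩
  weight (f [ a ]≔ 0) + f a  ≡⟨ ΣV-update f a 0 ⟩
  weight f + 0               ≡⟨ +-identityʳ _ ⟩
  weight f                   ∎
  where open ≡-Reasoning

weight-raise : ∀ {n} (f : Fin n → ℕ) a → f a ≡ 1 → weight (f [ a ]≔ 2) ≡ suc (weight f)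
weight-raise f a fa≡1 = +-cancelʳ-≡ 1 _ _ (begin
  weight (f [ a ]≔ 2) + 1    ≡⟨ cong (weight (f [ a ]≔ 2) +_) (sym fa≡1) ⟩
  weight (f [ a ]≔ 2) + f a  ≡⟨ ΣV-update f a 2 ⟩
  weight f + 2               ≡⟨ +-suc (weight f) 1 ⟩
  suc (weight f) + 1         ∎)
  where open ≡-Reasoning

module _ {N} (G : Graph N) where

  adj⇒≢ : ∀ {u v} → adj G u v ≡ true → u ≢ v
  adj⇒≢ {u} uv refl = contradiction (trans (sym uv) (adj-irr G u)) λ ()

  adj-swap : ∀ {u v b} → adj G u v ≡ b → adj G v u ≡ b
  adj-swap {u} {v} uv = trans (adj-sym G v u) uv

  nbrSum≤weight : ∀ f v → nbrSum G f v ≤ weight f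
  nbrSum≤weight f v = ΣV-mono λ u → if≤ (adj G v u)
    where
    if≤ : ∀ {x} b → (if b then x else 0) ≤ x
    if≤ true = ≤-refl
    if≤ false = z≤n

  nbrSum-≥-nbr : ∀ f {v x} → adj G v x ≡ true → f x ≤ nbrSum G f v
  nbrSum-≥-nbr f {v} {x} vx =
    subst (_≤ nbrSum G f v) (cong (λ b → if b then f x else 0) vx) (ΣV-≥-point _ x)

  nbrSum-≥-pair : ∀ f {v x y} → adj G v x ≡ true → adj G v y ≡ true → x ≢ y → f x + f y ≤ nbrSum G f v
  nbrSum-≥-pair f {v} {x} {y} vx vy x≢y = subst (_≤ nbrSum G f v)
    (cong₂ _+_ (cong (λ b → if b then f x else 0) vx) (cong (λ b → if b then f y else 0) vy))
    (ΣV-≥-pair _ x≢y)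

  weight-≥-2⊓order : ∀ f → IsR2DF G f → 2 ⊓ N ≤ weight f
  weight-≥-2⊓order f (_ , dominated) with any? (λ v → f v ℕ.≟ 0)
  ... | yes (v , fv≡0) = ≤-trans (m⊓n≤m 2 N) (≤-trans (dominated v fv≡0) (nbrSum≤weight f v))
  ... | no noZero = ≤-trans (m⊓n≤n 2 N) (subst (_≤ weight f) (ΣV-const-1 N)
          (ΣV-mono λ v → ℕ.n≢0⇒n>0 λ fv≡0 → noZero (v , fv≡0)))

  const1-isR2DF : IsR2DF G (const 1)
  const1-isR2DF = (λ _ → s≤s z≤n) , λ _ ()

≅-sym : ∀ {n m} {G : Graph n} {H : Graph m} → G ≅ H → H ≅ G
≅-sym {G = G} {H} (φ , adj≡) = ↔-sym φ , λ i j →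
  sym (trans (adj≡ (from i) (from j)) (cong₂ (adj H) (strictlyInverseˡ i) (strictlyInverseˡ j)))
  where open Inverse φ

≅⇒order≡ : ∀ {n m} {G : Graph n} {H : Graph m} → G ≅ H → n ≡ m
≅⇒order≡ (φ , _) = ↔⇒≡ φ

module _ {n m} (G : Graph n) (H : Graph m) (G≅H : G ≅ H) where
  private
    φ = proj₁ G≅H
    adj≡ = proj₂ G≅H
  open Inverse φ using (to)

  nbrSum-pullback : ∀ g u → nbrSum G (g ∘ to) u ≡ nbrSum H g (to u)
  nbrSum-pullback g u = begin
    ΣV (λ w → if adj G u w then g (to w) else 0)
      ≡⟨ ΣV-cong (λ w → cong (λ b → if b then g (to w) else 0) (adj≡ u w)) ⟩
    ΣV ((λ j → if adj H (to u) j then g j else 0) ∘ to)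
      ≡⟨ sym (ΣV-permute φ _) ⟩
    ΣV (λ j → if adj H (to u) j then g j else 0) ∎
    where open ≡-Reasoning

  R2DF-pullback : ∀ g → IsR2DF H g → IsR2DF G (g ∘ to)
  R2DF-pullback g (bounded , dominated) =
    bounded ∘ to , λ u gu≡0 → subst (2 ≤_) (sym (nbrSum-pullback g u)) (dominated (to u) gu≡0)

  weight-pullback : ∀ g → weight (g ∘ to) ≡ weight g
  weight-pullback g = sym (ΣV-permute φ g)

γR2≡-≅ : ∀ {n m} {G : Graph n} {H : Graph m} {k} → G ≅ H → γR2≡ H k → γR2≡ G k
γR2≡-≅ {G = G} {H} {k} G≅H ((g , g-R2DF , g-weight) , minimal) =
  (g ∘ Inverse.to (proj₁ G≅H) , R2DF-pullback G H G≅H g g-R2DF ,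
   trans (weight-pullback G H G≅H g) g-weight) ,
  λ f f-R2DF → subst (k ≤_) (weight-pullback H G H≅G f) (minimal _ (R2DF-pullback H G H≅G f f-R2DF))
  where H≅G = ≅-sym {G = G} {H} G≅H

_∉_ : ∀ {k} {A : Set} → A → (Fin k → A) → Set
y ∉ p = ∀ i → p i ≢ y

∷-injective : ∀ {k} {A : Set} {p : Fin k → A} {y} →
  y ∉ p → Injective _≡_ _≡_ p → Injective _≡_ _≡_ (y ∷ p)
∷-injective y∉p p-inj {zero} {zero} _ = refl
∷-injective y∉p p-inj {zero} {suc j} y≡pj = contradiction (sym y≡pj) (y∉p j)
∷-injective y∉p p-inj {suc i} {zero} pi≡y = contradiction pi≡y (y∉p i)
∷-injective y∉p p-inj {suc i} {suc j} pi≡pj = cong suc (p-inj pi≡pj)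

injective⇒surjective : ∀ {k} {p : Fin k → Fin k} → Injective _≡_ _≡_ p → ∀ u → ∃ λ i → p i ≡ u
injective⇒surjective {p = p} p-inj u with any? (λ i → p i ≟ u)
... | yes hit = hit
... | no miss = contradiction (injective⇒≤ (∷-injective (λ i pi≡u → miss (i , pi≡u)) p-inj)) 1+n≰n

≅-fromInjection : ∀ {k} (G H : Graph k) (p : Fin k → Fin k) → Injective _≡_ _≡_ p →
  (∀ i j → adj G (p i) (p j) ≡ adj H i j) → G ≅ H
≅-fromInjection G H p p-inj adj≡ =
  mk↔ₛ′ p⁻¹ p (λ i → p-inj (p∘p⁻¹ (p i))) p∘p⁻¹ ,
  λ u v → trans (cong₂ (adj G) (sym (p∘p⁻¹ u)) (sym (p∘p⁻¹ v))) (adj≡ (p⁻¹ u) (p⁻¹ v))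
  where
  p⁻¹ = proj₁ ∘ injective⇒surjective p-inj
  p∘p⁻¹ = proj₂ ∘ injective⇒surjective p-inj

missedVertex : ∀ {k N} → k < N → (p : Fin k → Fin N) → ∃ (_∉ p)
missedVertex {k} {N} k<N p
  with ¬∀⟶∃¬ N (λ u → ∃ λ i → p i ≡ u) (λ u → any? (λ i → p i ≟ u)) notOnto
  where
  notOnto : ¬ (∀ u → ∃ λ i → p i ≡ u)
  notOnto onto = <⇒≱ k<N (injective⇒≤ λ {u} {v} same →
    trans (sym (proj₂ (onto u))) (trans (cong p same) (proj₂ (onto v))))
... | u , missed = u , λ i pi≡u → missed (i , pi≡u)

walk-exits : ∀ {N} (G : Graph N) {S : Fin N → Set} → Decidable S →
  ∀ {u v} → Walk G u v → S u → ¬ S v → ∃₂ λ x y → S x × ¬ S y × adj G x y ≡ true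
walk-exits G S? here Su ¬Sv = contradiction Su ¬Sv
walk-exits G S? (step {w = w} uw rest) Su ¬Sv with S? w
... | yes Sw = walk-exits G S? rest Sw ¬Sv
... | no ¬Sw = _ , w , Su , ¬Sw , uw

exitEdge : ∀ {N k} (G : Graph N) → Connected G → suc k < N → (p : Fin (suc k) → Fin N) →
  ∃₂ λ i y → y ∉ p × adj G (p i) y ≡ true
exitEdge G con k<N p with missedVertex k<N p
... | t , t∉p
  with walk-exits G (λ u → any? (λ i → p i ≟ u)) (con (p zero) t) (zero , refl) (λ (i , pi≡t) → t∉p i pi≡t)
... | x , y , (i , pi≡x) , y∉p , xy =
  i , y , (λ j pj≡y → y∉p (j , pj≡y)) , subst (λ v → adj G v y ≡ true) (sym pi≡x) xy

record Path {N} (G : Graph N) (k : ℕ) : Set where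
  field
    vertex : Fin (suc k) → Fin N
    vertex-injective : Injective _≡_ _≡_ vertex
    consecutive : ∀ i → adj G (vertex (inject₁ i)) (vertex (suc i)) ≡ true
open Path

record Claw {N} (G : Graph N) : Set where
  field
    centre leaf₁ leaf₂ leaf₃ : Fin N
    centre-leaf₁ : adj G centre leaf₁ ≡ true
    centre-leaf₂ : adj G centre leaf₂ ≡ true
    centre-leaf₃ : adj G centre leaf₃ ≡ true
    leaf₁≢leaf₂ : leaf₁ ≢ leaf₂
    leaf₁≢leaf₃ : leaf₁ ≢ leaf₃
    leaf₂≢leaf₃ : leaf₂ ≢ leaf₃

opposite-inject₁ : ∀ {k} (i : Fin k) → opposite (inject₁ i) ≡ suc (opposite i)
opposite-inject₁ {suc k} zero = refl
opposite-inject₁ {suc k} (suc i) = cong inject₁ (opposite-inject₁ i)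

opposite-injective : ∀ {k} → Injective _≡_ _≡_ (opposite {k})
opposite-injective {x = i} {j} same =
  trans (sym (opposite-involutive i)) (trans (cong opposite same) (opposite-involutive j))

module _ {N} {G : Graph N} where

  vertex-≢ : ∀ {k} (Q : Path G k) {i j} → i ≢ j → vertex Q i ≢ vertex Q j
  vertex-≢ Q i≢j same = i≢j (vertex-injective Q same)

  singleton : Fin N → Path G 0
  singleton v = record
    { vertex = const v ; vertex-injective = λ { {zero} {zero} _ → refl } ; consecutive = λ () }

  reverse : ∀ {k} → Path G k → Path G k
  reverse Q = record
    { vertex = vertex Q ∘ opposite
    ; vertex-injective = opposite-injective ∘ vertex-injective Q
    ; consecutive = λ i →
        subst (λ j → adj G (vertex Q j) (vertex Q (inject₁ (opposite i))) ≡ true) (sym (opposite-inject₁ i))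
          (adj-swap G (consecutive Q (opposite i))) }

  extendAtStart : ∀ {k y} (Q : Path G k) → y ∉ vertex Q → adj G y (vertex Q zero) ≡ true → Path G (suc k)
  extendAtStart {y = y} Q y∉Q y-start = record
    { vertex = y ∷ vertex Q
    ; vertex-injective = ∷-injective y∉Q (vertex-injective Q)
    ; consecutive = λ { zero → y-start ; (suc i) → consecutive Q i } }

  extendAtEnd : ∀ {k y} (Q : Path G k) → y ∉ vertex Q → adj G (vertex Q (fromℕ k)) y ≡ true → Path G (suc k)
  extendAtEnd Q y∉Q end-y = extendAtStart (reverse Q) (y∉Q ∘ opposite) (adj-swap G end-y)

  -- The vertex suc j = inject₁ l of Q has path neighbours inject₁ j and suc l.
  interiorClaw : ∀ {k y} (Q : Path G k) (j l : Fin k) → inject₁ l ≡ suc j → y ∉ vertex Q →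
    adj G (vertex Q (suc j)) y ≡ true → Claw G
  interiorClaw {y = y} Q j l l≡suc-j y∉Q centre-y = record
    { centre = vertex Q (suc j) ; leaf₁ = vertex Q (inject₁ j) ; leaf₂ = vertex Q (suc l) ; leaf₃ = y
    ; centre-leaf₁ = adj-swap G (consecutive Q j)
    ; centre-leaf₂ = subst (λ i → adj G (vertex Q i) (vertex Q (suc l)) ≡ true) l≡suc-j (consecutive Q l)
    ; centre-leaf₃ = centre-y
    ; leaf₁≢leaf₂ = λ same → ℕ.<-asym (before (vertex-injective Q same)) (ℕ.≤-reflexive (sym l≡suc-j′))
    ; leaf₁≢leaf₃ = y∉Q (inject₁ j)
    ; leaf₂≢leaf₃ = y∉Q (suc l) }
    where
    l≡suc-j′ : toℕ l ≡ suc (toℕ j)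
    l≡suc-j′ = trans (sym (toℕ-inject₁ l)) (cong toℕ l≡suc-j)
    before : inject₁ j ≡ suc l → toℕ l < toℕ j
    before same = ℕ.≤-reflexive (sym (trans (sym (toℕ-inject₁ j)) (cong toℕ same)))

  grow : ∀ {k} → Connected G → suc k < N → Path G k → Path G (suc k) ⊎ Claw G
  grow {k} con k<N Q with exitEdge G con k<N (vertex Q)
  ... | zero , y , y∉Q , start-y = inj₁ (extendAtStart Q y∉Q (adj-swap G start-y))
  ... | suc j , y , y∉Q , j-y with k ℕ.≟ toℕ (suc j)
  ...   | yes k≡j+1 = inj₁ (extendAtEnd Q y∉Q (subst (λ i → adj G (vertex Q i) y ≡ true) j+1≡end j-y))
    where j+1≡end = toℕ-injective (trans (sym k≡j+1) (sym (toℕ-fromℕ k)))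
  ...   | no k≢j+1 =
    inj₂ (interiorClaw Q j (lower₁ (suc j) k≢j+1) (inject₁-lower₁ (suc j) k≢j+1) y∉Q j-y)

pathOrClaw : ∀ {n} {G : Graph (suc n)} → Connected G → ∀ k → k ≤ n → Path G k ⊎ Claw G
pathOrClaw con zero _ = inj₁ (singleton zero)
pathOrClaw con (suc k) k<n with pathOrClaw con k (<⇒≤ k<n)
... | inj₁ Q = grow con (s≤s k<n) Q
... | inj₂ claw = inj₂ claw

CheapR2DF : ∀ {N} → Graph N → ℕ → Set
CheapR2DF {N} G s = ∃ λ f → IsR2DF G f × weight f + s ≡ N

record Cherry {N} (G : Graph N) : Set where
  field
    centre left right : Fin N
    centre-left : adj G centre left ≡ true
    centre-right : adj G centre right ≡ true
    left≢right : left ≢ right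
open Cherry

module _ {N} {G : Graph N} where

  middleCherry : ∀ {k} → Path G (suc (suc k)) → Cherry G
  middleCherry Q = record
    { centre = vertex Q 1F ; left = vertex Q 0F ; right = vertex Q 2F
    ; centre-left = adj-swap G (consecutive Q 0F) ; centre-right = consecutive Q 1F
    ; left≢right = vertex-≢ Q λ () }

  clawCherry : Claw G → Cherry G
  clawCherry K = record
    { centre = Claw.centre K ; left = Claw.leaf₁ K ; right = Claw.leaf₂ K
    ; centre-left = Claw.centre-leaf₁ K ; centre-right = Claw.centre-leaf₂ K
    ; left≢right = Claw.leaf₁≢leaf₂ K }

  dominatedByOnes : ∀ f {v x y} → adj G v x ≡ true → adj G v y ≡ true → x ≢ y → f x ≡ 1 → f y ≡ 1 →
    2 ≤ nbrSum G f v
  dominatedByOnes f {v} vx vy x≢y fx≡1 fy≡1 =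
    subst (_≤ nbrSum G f v) (cong₂ _+_ fx≡1 fy≡1) (nbrSum-≥-pair G f vx vy x≢y)

  dominatedByTwo : ∀ f {v x} → adj G v x ≡ true → f x ≡ 2 → 2 ≤ nbrSum G f v
  dominatedByTwo f {v} vx fx≡2 = subst (_≤ nbrSum G f v) fx≡2 (nbrSum-≥-nbr G f vx)

  cherry⇒cheap : Cherry G → CheapR2DF G 1
  cherry⇒cheap C = f , (bounded , dominated) , trans (+-comm (weight f) 1) weight≡
    where
    f = const 1 [ centre C ]≔ 0
    bounded = []≔-bounded (const 1) (centre C) (λ _ → s≤s z≤n) z≤n
    isOne : ∀ {v} → adj G (centre C) v ≡ true → f v ≡ 1
    isOne cv = []≔-minimal (const 1) 0 (adj⇒≢ G cv ∘ sym)
    dominated : ∀ u → f u ≡ 0 → 2 ≤ nbrSum G f u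
    dominated u fu≡0 with []≔-zero (const 1) (centre C) 0 u fu≡0
    ... | inj₁ refl = dominatedByOnes f (centre-left C) (centre-right C) (left≢right C)
                        (isOne (centre-left C)) (isOne (centre-right C))
    weight≡ : suc (weight f) ≡ N
    weight≡ = trans (weight-zeroOut {N} (const 1) (centre C) refl) (ΣV-const-1 N)

  twoCherries⇒cheap : (C D : Cherry G) → centre C ≢ centre D →
    centre D ≢ left C → centre D ≢ right C → centre C ≢ left D → centre C ≢ right D → CheapR2DF G 2
  twoCherries⇒cheap C D c≢d d≢lC d≢rC c≢lD c≢rD =
    f , (bounded , dominated) , trans (+-comm (weight f) 2) weight≡
    where
    g = const 1 [ centre C ]≔ 0
    f = g [ centre D ]≔ 0
    bounded = []≔-bounded g (centre D) ([]≔-bounded (const 1) (centre C) (λ _ → s≤s z≤n) z≤n) z≤n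
    isOne : ∀ {v} → centre C ≢ v → centre D ≢ v → f v ≡ 1
    isOne c≢v d≢v = trans ([]≔-minimal g 0 (d≢v ∘ sym)) ([]≔-minimal (const 1) 0 (c≢v ∘ sym))
    dominated : ∀ u → f u ≡ 0 → 2 ≤ nbrSum G f u
    dominated u fu≡0 with []≔-zero g (centre D) 0 u fu≡0
    ... | inj₁ refl = dominatedByOnes f (centre-left D) (centre-right D) (left≢right D)
                        (isOne c≢lD (adj⇒≢ G (centre-left D))) (isOne c≢rD (adj⇒≢ G (centre-right D)))
    ... | inj₂ gu≡0 with []≔-zero (const 1) (centre C) 0 u gu≡0
    ...   | inj₁ refl = dominatedByOnes f (centre-left C) (centre-right C) (left≢right C)
                          (isOne (adj⇒≢ G (centre-left C)) d≢lC) (isOne (adj⇒≢ G (centre-right C)) d≢rC)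
    weight≡ : suc (suc (weight f)) ≡ N
    weight≡ = begin
      suc (suc (weight f))
        ≡⟨ cong suc (weight-zeroOut g (centre D) ([]≔-minimal (const 1) 0 (c≢d ∘ sym))) ⟩
      suc (weight g)       ≡⟨ weight-zeroOut {N} (const 1) (centre C) refl ⟩
      weight {N} (const 1) ≡⟨ ΣV-const-1 N ⟩
      N                    ∎
      where open ≡-Reasoning

  module ClawLabelling (K : Claw G) where
    open Claw K renaming (centre to c; centre-leaf₁ to c-l₁; centre-leaf₂ to c-l₂; centre-leaf₃ to c-l₃)

    g₁ g₂ g₃ f : Fin N → ℕ
    g₁ = const 1 [ c ]≔ 2
    g₂ = g₁ [ leaf₁ ]≔ 0
    g₃ = g₂ [ leaf₂ ]≔ 0
    f = g₃ [ leaf₃ ]≔ 0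

    bounded : ∀ u → f u ≤ 2
    bounded = []≔-bounded g₃ leaf₃ ([]≔-bounded g₂ leaf₂ ([]≔-bounded g₁ leaf₁
                ([]≔-bounded (const 1) c (λ _ → s≤s z≤n) ≤-refl) z≤n) z≤n) z≤n

    f-c : f c ≡ 2
    f-c = trans ([]≔-minimal g₃ 0 (adj⇒≢ G c-l₃)) (trans ([]≔-minimal g₂ 0 (adj⇒≢ G c-l₂))
            (trans ([]≔-minimal g₁ 0 (adj⇒≢ G c-l₁)) ([]≔-updates (const 1) c 2)))

    dominated : ∀ u → f u ≡ 0 → 2 ≤ nbrSum G f u
    dominated u fu≡0 with []≔-zero g₃ leaf₃ 0 u fu≡0
    ... | inj₁ refl = dominatedByTwo f (adj-swap G c-l₃) f-c
    ... | inj₂ g₃u≡0 with []≔-zero g₂ leaf₂ 0 u g₃u≡0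
    ...   | inj₁ refl = dominatedByTwo f (adj-swap G c-l₂) f-c
    ...   | inj₂ g₂u≡0 with []≔-zero g₁ leaf₁ 0 u g₂u≡0
    ...     | inj₁ refl = dominatedByTwo f (adj-swap G c-l₁) f-c
    ...     | inj₂ g₁u≡0 with []≔-zero (const 1) c 2 u g₁u≡0
    ...       | inj₁ refl = contradiction (trans (sym ([]≔-updates (const 1) c 2)) g₁u≡0) λ ()

    g₁-l₁ : g₁ leaf₁ ≡ 1
    g₁-l₁ = []≔-minimal (const 1) 2 (adj⇒≢ G c-l₁ ∘ sym)
    g₂-l₂ : g₂ leaf₂ ≡ 1
    g₂-l₂ = trans ([]≔-minimal g₁ 0 (leaf₁≢leaf₂ ∘ sym)) ([]≔-minimal (const 1) 2 (adj⇒≢ G c-l₂ ∘ sym))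
    g₃-l₃ : g₃ leaf₃ ≡ 1
    g₃-l₃ = trans ([]≔-minimal g₂ 0 (leaf₂≢leaf₃ ∘ sym))
              (trans ([]≔-minimal g₁ 0 (leaf₁≢leaf₃ ∘ sym)) ([]≔-minimal (const 1) 2 (adj⇒≢ G c-l₃ ∘ sym)))

    weight≡ : weight f + 2 ≡ N
    weight≡ = trans (+-comm (weight f) 2) (suc-injective (begin
      3 + weight f    ≡⟨ cong (2 +_) (weight-zeroOut g₃ leaf₃ g₃-l₃) ⟩
      2 + weight g₃   ≡⟨ cong suc (weight-zeroOut g₂ leaf₂ g₂-l₂) ⟩
      1 + weight g₂   ≡⟨ weight-zeroOut g₁ leaf₁ g₁-l₁ ⟩
      weight g₁       ≡⟨ weight-raise (const 1) c refl ⟩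
      1 + weight {N} (const 1) ≡⟨ cong suc (ΣV-const-1 N) ⟩
      1 + N           ∎))
      where open ≡-Reasoning

  claw⇒cheap : Claw G → CheapR2DF G 2
  claw⇒cheap K = f , (bounded , dominated) , weight≡
    where open ClawLabelling K

  path₄⇒cheap : Path G 4 → CheapR2DF G 2
  path₄⇒cheap Q = twoCherries⇒cheap (middleCherry Q) (middleCherry (reverse Q))
    (vertex-≢ Q λ ()) (vertex-≢ Q λ ()) (vertex-≢ Q λ ()) (vertex-≢ Q λ ()) (vertex-≢ Q λ ())

≅-fromSpanningPath₂ : (G H : Graph 3) (Q : Path G 2) →
  adj H 0F 1F ≡ true → adj H 1F 2F ≡ true → adj G (vertex Q 0F) (vertex Q 2F) ≡ adj H 0F 2F → G ≅ H
≅-fromSpanningPath₂ G H Q h₀₁ h₁₂ chord = ≅-fromInjection G H (vertex Q) (vertex-injective Q) table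
  where
  table : ∀ i j → adj G (vertex Q i) (vertex Q j) ≡ adj H i j
  table 0F 0F = trans (adj-irr G _) (sym (adj-irr H 0F))
  table 0F 1F = trans (consecutive Q 0F) (sym h₀₁)
  table 0F 2F = chord
  table 1F 0F = trans (adj-swap G (consecutive Q 0F)) (sym (adj-swap H h₀₁))
  table 1F 1F = trans (adj-irr G _) (sym (adj-irr H 1F))
  table 1F 2F = trans (consecutive Q 1F) (sym h₁₂)
  table 2F 0F = trans (adj-swap G chord) (adj-sym H 0F 2F)
  table 2F 1F = trans (adj-swap G (consecutive Q 1F)) (sym (adj-swap H h₁₂))
  table 2F 2F = trans (adj-irr G _) (sym (adj-irr H 2F))

classify₃ : (G : Graph 3) → Path G 2 → G ≅ C₃ ⊎ G ≅ P 3
classify₃ G Q with adj G (vertex Q 0F) (vertex Q 2F) in chord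
... | true = inj₁ (≅-fromSpanningPath₂ G C₃ Q refl refl chord)
... | false = inj₂ (≅-fromSpanningPath₂ G (P 3) Q refl refl chord)

classify₄ : (G : Graph 4) → Path G 3 → CheapR2DF G 2 ⊎ G ≅ P 4
classify₄ G Q with adj G (vertex Q 0F) (vertex Q 2F) in c₀₂ | adj G (vertex Q 1F) (vertex Q 3F) in c₁₃
                 | adj G (vertex Q 0F) (vertex Q 3F) in c₀₃
... | true | _ | _ = inj₁ (claw⇒cheap {G = G} record
  { centre = vertex Q 2F ; leaf₁ = vertex Q 1F ; leaf₂ = vertex Q 3F ; leaf₃ = vertex Q 0F
  ; centre-leaf₁ = adj-swap G (consecutive Q 1F) ; centre-leaf₂ = consecutive Q 2F ; centre-leaf₃ = adj-swap G c₀₂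
  ; leaf₁≢leaf₂ = vertex-≢ Q λ () ; leaf₁≢leaf₃ = vertex-≢ Q λ () ; leaf₂≢leaf₃ = vertex-≢ Q λ () })
... | false | true | _ = inj₁ (claw⇒cheap {G = G} record
  { centre = vertex Q 1F ; leaf₁ = vertex Q 0F ; leaf₂ = vertex Q 2F ; leaf₃ = vertex Q 3F
  ; centre-leaf₁ = adj-swap G (consecutive Q 0F) ; centre-leaf₂ = consecutive Q 1F ; centre-leaf₃ = c₁₃
  ; leaf₁≢leaf₂ = vertex-≢ Q λ () ; leaf₁≢leaf₃ = vertex-≢ Q λ () ; leaf₂≢leaf₃ = vertex-≢ Q λ () })
... | false | false | true = inj₁ (twoCherries⇒cheap {G = G}
  (record { centre = vertex Q 0F ; left = vertex Q 1F ; right = vertex Q 3F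
          ; centre-left = consecutive Q 0F ; centre-right = c₀₃ ; left≢right = vertex-≢ Q λ () })
  (record { centre = vertex Q 2F ; left = vertex Q 1F ; right = vertex Q 3F
          ; centre-left = adj-swap G (consecutive Q 1F) ; centre-right = consecutive Q 2F
          ; left≢right = vertex-≢ Q λ () })
  (vertex-≢ Q λ ()) (vertex-≢ Q λ ()) (vertex-≢ Q λ ()) (vertex-≢ Q λ ()) (vertex-≢ Q λ ()))
... | false | false | false = inj₂ (≅-fromInjection G (P 4) (vertex Q) (vertex-injective Q) table)
  where
  table : ∀ i j → adj G (vertex Q i) (vertex Q j) ≡ adj (P 4) i j
  table 0F 0F = adj-irr G _
  table 0F 1F = consecutive Q 0F
  table 0F 2F = c₀₂
  table 0F 3F = c₀₃
  table 1F 0F = adj-swap G (consecutive Q 0F)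
  table 1F 1F = adj-irr G _
  table 1F 2F = consecutive Q 1F
  table 1F 3F = c₁₃
  table 2F 0F = adj-swap G c₀₂
  table 2F 1F = adj-swap G (consecutive Q 1F)
  table 2F 2F = adj-irr G _
  table 2F 3F = consecutive Q 2F
  table 3F 0F = adj-swap G c₀₃
  table 3F 1F = adj-swap G c₁₃
  table 3F 2F = adj-swap G (consecutive Q 2F)
  table 3F 3F = adj-irr G _

isR2DF? : ∀ {N} (G : Graph N) f → Dec (IsR2DF G f)
isR2DF? G f = all? (λ v → f v ℕ.≤? 2) ×-dec all? (λ v → (f v ℕ.≟ 0) →-dec (2 ℕ.≤? nbrSum G f v))

γR2≡-C₃ : γR2≡ C₃ 2
γR2≡-C₃ = (f , from-yes (isR2DF? C₃ f) , refl) , weight-≥-2⊓order C₃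
  where f = 2 ∷ 0 ∷ 0 ∷ []

γR2≡-P₃ : γR2≡ (P 3) 2
γR2≡-P₃ = (f , from-yes (isR2DF? (P 3) f) , refl) , weight-≥-2⊓order (P 3)
  where f = 0 ∷ 2 ∷ 0 ∷ []

-- In a - b - c - d, each end pair {a, b}, {c, d} has weight at least 1, and one of them at least 2.
path₄-weight-bound : ∀ a b c d →
  (a ≡ 0 → 2 ≤ b) → (b ≡ 0 → 2 ≤ a + c) → (c ≡ 0 → 2 ≤ b + d) → (d ≡ 0 → 2 ≤ c) → 3 ≤ a + b + (c + d)
path₄-weight-bound a b c d dom-a dom-b dom-c dom-d = combine (heavyEnd a b c d dom-a dom-b dom-c dom-d)
  where
  heavyEnd : ∀ a b c d →
    (a ≡ 0 → 2 ≤ b) → (b ≡ 0 → 2 ≤ a + c) → (c ≡ 0 → 2 ≤ b + d) → (d ≡ 0 → 2 ≤ c) → 2 ≤ a + b ⊎ 2 ≤ c + d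
  heavyEnd zero b c d dom-a _ _ _ = inj₁ (dom-a refl)
  heavyEnd (suc a) b c zero _ _ _ dom-d = inj₂ (≤-trans (dom-d refl) (m≤m+n c 0))
  heavyEnd (suc a) (suc b) c (suc d) _ _ _ _ = inj₁ (s≤s (≤-trans (s≤s z≤n) (m≤n+m (suc b) a)))
  heavyEnd (suc a) zero (suc c) (suc d) _ _ _ _ = inj₂ (s≤s (≤-trans (s≤s z≤n) (m≤n+m (suc d) c)))
  heavyEnd (suc a) zero zero (suc d) _ dom-b _ _ = inj₁ (dom-b refl)
  endPair : ∀ x y → (x ≡ 0 → 2 ≤ y) → 1 ≤ x + y
  endPair zero y dom-x = ≤-trans (s≤s z≤n) (dom-x refl)
  endPair (suc x) y _ = s≤s z≤n
  combine : 2 ≤ a + b ⊎ 2 ≤ c + d → 3 ≤ a + b + (c + d)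
  combine (inj₁ heavy) = +-mono-≤ heavy (subst (1 ≤_) (+-comm d c) (endPair d c dom-d))
  combine (inj₂ heavy) = +-mono-≤ (endPair a b dom-a) heavy

γR2≡-P₄ : γR2≡ (P 4) 3
γR2≡-P₄ = (f , from-yes (isR2DF? (P 4) f) , refl) , lowerBound
  where
  f = 0 ∷ 2 ∷ 0 ∷ 1 ∷ []
  lowerBound : ∀ g → IsR2DF (P 4) g → 3 ≤ weight g
  lowerBound g (_ , dominated) = subst (3 ≤_) weight≡ (path₄-weight-bound a b c d
    (λ a≡0 → ≤-trans (dominated 0F a≡0) (ℕ.≤-reflexive (+-identityʳ b)))
    (λ b≡0 → ≤-trans (dominated 1F b≡0) (ℕ.≤-reflexive (cong (a +_) (+-identityʳ c))))
    (λ c≡0 → ≤-trans (dominated 2F c≡0) (ℕ.≤-reflexive (cong (b +_) (+-identityʳ d))))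
    (λ d≡0 → ≤-trans (dominated 3F d≡0) (ℕ.≤-reflexive (+-identityʳ c))))
    where
    a = g 0F ; b = g 1F ; c = g 2F ; d = g 3F
    weight≡ : a + b + (c + d) ≡ weight g
    weight≡ = trans (+-assoc a b (c + d)) (cong (λ x → a + (b + (c + x))) (sym (+-identityʳ d)))

γR2≡-≥-2⊓order : ∀ {N} (G : Graph N) {k} → γR2≡ G k → 2 ⊓ N ≤ k
γR2≡-≥-2⊓order G ((f , f-R2DF , weight≡) , _) = subst (_ ≤_) weight≡ (weight-≥-2⊓order G f f-R2DF)

cheap⇒γR2+s≤order : ∀ {N} (G : Graph N) {k s} → γR2≡ G k → CheapR2DF G s → k + s ≤ N
cheap⇒γR2+s≤order G {s = s} (_ , minimal) (f , f-R2DF , weight≡) =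
  subst (_ + s ≤_) weight≡ (+-monoˡ-≤ s (minimal f f-R2DF))

order≤2⇒γR2≡order : ∀ {N} (G : Graph N) → N ≤ 2 → γR2≡ G N
order≤2⇒γR2≡order {N} G N≤2 = (const 1 , const1-isR2DF G , ΣV-const-1 N) ,
  λ f f-R2DF → subst (_≤ weight f) (ℕ.m≥n⇒m⊓n≡n N≤2) (weight-≥-2⊓order G f f-R2DF)

connected⇒cherry : ∀ {n} {G : Graph (3 + n)} → Connected G → Cherry G
connected⇒cherry con with pathOrClaw con 2 (s≤s (s≤s z≤n))
... | inj₁ Q = middleCherry Q
... | inj₂ K = clawCherry K

connected₂⇒complete : (G : Graph 2) → Connected G → IsComplete G
connected₂⇒complete G con 0F 1F _ = edge₀₁
  where
  edge₀₁ : adj G 0F 1F ≡ true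
  edge₀₁ with con 0F 1F
  ... | step {w = 0F} 0-0 _ = contradiction refl (adj⇒≢ G 0-0)
  ... | step {w = 1F} 0-1 _ = 0-1
connected₂⇒complete G con 1F 0F _ = adj-swap G (connected₂⇒complete G con 0F 1F λ ())
connected₂⇒complete G con 0F 0F 0≢0 = contradiction refl 0≢0
connected₂⇒complete G con 1F 1F 1≢1 = contradiction refl 1≢1

γR2≡order⇒complete : ∀ n (G : Graph (suc n)) → Connected G → γR2≡ G (suc n) →
  (suc n ≡ 1 ⊎ suc n ≡ 2) × IsComplete G
γR2≡order⇒complete 0 G _ _ = inj₁ refl , λ { 0F 0F 0≢0 → contradiction refl 0≢0 }
γR2≡order⇒complete 1 G con _ = inj₂ refl , connected₂⇒complete G con
γR2≡order⇒complete (suc (suc n)) G con γ =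
  contradiction (cheap⇒γR2+s≤order G γ (cherry⇒cheap (connected⇒cherry con))) (ℕ.m+1+n≰m (3 + n))

γR2≡order∸1⇒¬cheap₂ : ∀ {n} (G : Graph (suc n)) → γR2≡ G n → ¬ CheapR2DF G 2
γR2≡order∸1⇒¬cheap₂ {n} G γ cheap =
  ℕ.m+1+n≰m (suc n) (subst (_≤ suc n) (+-suc n 1) (cheap⇒γR2+s≤order G γ cheap))

γR2≡order∸1⇒classified : ∀ n (G : Graph (suc n)) → Connected G → γR2≡ G n →
  G ≅ C₃ ⊎ G ≅ P 3 ⊎ G ≅ P 4
γR2≡order∸1⇒classified 0 G _ γ with γR2≡-≥-2⊓order G γ
... | ()
γR2≡order∸1⇒classified 1 G _ γ with γR2≡-≥-2⊓order G γ
... | s≤s ()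
γR2≡order∸1⇒classified 2 G con γ with pathOrClaw con 2 ≤-refl
... | inj₂ K = contradiction (claw⇒cheap K) (γR2≡order∸1⇒¬cheap₂ G γ)
... | inj₁ Q with classify₃ G Q
...   | inj₁ G≅C₃ = inj₁ G≅C₃
...   | inj₂ G≅P₃ = inj₂ (inj₁ G≅P₃)
γR2≡order∸1⇒classified 3 G con γ with pathOrClaw con 3 ≤-refl
... | inj₂ K = contradiction (claw⇒cheap K) (γR2≡order∸1⇒¬cheap₂ G γ)
... | inj₁ Q with classify₄ G Q
...   | inj₁ cheap = contradiction cheap (γR2≡order∸1⇒¬cheap₂ G γ)
...   | inj₂ G≅P₄ = inj₂ (inj₂ G≅P₄)
γR2≡order∸1⇒classified (suc (suc (suc (suc n)))) G con γ with pathOrClaw con 4 (m≤m+n 4 n)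
... | inj₁ Q = contradiction (path₄⇒cheap Q) (γR2≡order∸1⇒¬cheap₂ G γ)
... | inj₂ K = contradiction (claw⇒cheap K) (γR2≡order∸1⇒¬cheap₂ G γ)

classified⇒γR2≡order∸1 : ∀ n (G : Graph (suc n)) → G ≅ C₃ ⊎ G ≅ P 3 ⊎ G ≅ P 4 → γR2≡ G n
classified⇒γR2≡order∸1 n G (inj₁ G≅C₃) with ≅⇒order≡ {G = G} {C₃} G≅C₃
... | refl = γR2≡-≅ {G = G} {C₃} G≅C₃ γR2≡-C₃
classified⇒γR2≡order∸1 n G (inj₂ (inj₁ G≅P₃)) with ≅⇒order≡ {G = G} {P 3} G≅P₃
... | refl = γR2≡-≅ {G = G} {P 3} G≅P₃ γR2≡-P₃
classified⇒γR2≡order∸1 n G (inj₂ (inj₂ G≅P₄)) with ≅⇒order≡ {G = G} {P 4} G≅P₄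
... | refl = γR2≡-≅ {G = G} {P 4} G≅P₄ γR2≡-P₄

proposition2p4 : (n : ℕ) → (G : Graph (suc n)) → Connected G →
    (γR2≡ G (suc n) ⇔ ((suc n ≡ 1 ⊎ suc n ≡ 2) × IsComplete G))
    × (γR2≡ G (suc n ∸ 1) ⇔ (G ≅ C₃ ⊎ G ≅ P 3 ⊎ G ≅ P 4))
proposition2p4 n G con =
  mk⇔ (γR2≡order⇒complete n G con) (λ (small , _) → order≤2⇒γR2≡order G (order≤2 small)) ,
  mk⇔ (γR2≡order∸1⇒classified n G con) (classified⇒γR2≡order∸1 n G)
  where
  order≤2 : suc n ≡ 1 ⊎ suc n ≡ 2 → suc n ≤ 2
  order≤2 (inj₁ refl) = s≤s z≤n
  order≤2 (inj₂ refl) = ≤-refl
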